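{- Let $k\ge 3$ and $n\ge 2$ be integers and let $\mathcal{H}_{k,n}$ be the hinge graph obtained by gluing $n$ copies of the $k$-cycle along one common edge. Then $$K(\mathcal{H}_{k,n})\cong (\mathbb{Z}/(k-1)\mathbb{Z})^{n-2}\oplus \mathbb{Z}/(k^2+nk-2k-n+1)\mathbb{Z}.$$
   Context: The hinge graph $\mathcal{H}_{k,n}$ is the simple graph with two distinguished vertices $x,y$ joined by an edge $xy$, together with $n$ internally vertex-disjoint paths from $x$ to $y$, each having $k-2$ internal vertices (equivalently, $n$ copies of the $k$-cycle glued along a common edge). The critical group $K(G)$ of a finite connected graph $G$ is the group of degree-zero divisors (formal $\mathbb{Z}$-combinations of vertices with coefficient sum $0$) modulo the image of the graph Laplacian, i.e., the torsion part of the cokernel of the Laplacian. -}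

module Defs where

open import Function using (_∘_)
open import Data.Nat as ℕ using (ℕ; zero; suc; _∸_)
open import Data.Integer using (ℤ; +_; 0ℤ; 1ℤ; _+_; _-_; _*_; -_)
open import Data.Integer.Properties
  using (+-commutativeSemigroup; neg-distrib-+; +-identityˡ)
open import Data.Integer.Divisibility using (_∣_)
open import Data.Fin using (Fin; toℕ) renaming (zero to fzero; suc to fsuc)
open import Data.Bool using (Bool; true; false; if_then_else_; _∧_; _∨_)
open import Data.Product using (Σ; ∃; _×_; _,_; proj₁; proj₂)
open import Relation.Binary.PropositionalEquality
open import Level using (0ℓ)
open import Algebra.Bundles.Raw using (RawGroup)
open import Algebra.Properties.CommutativeSemigroup +-commutativeSemigroup
  using (interchange)

sumFin : ∀ {m} → (Fin m → ℤ) → ℤ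
sumFin {zero}  f = 0ℤ
sumFin {suc m} f = f fzero + sumFin (f ∘ fsuc)

sumFin-+ : ∀ {m} (f g : Fin m → ℤ) →
           sumFin (λ i → f i + g i) ≡ sumFin f + sumFin g
sumFin-+ {zero}  f g = refl
sumFin-+ {suc m} f g =
  trans (cong (_+_ (f fzero + g fzero)) (sumFin-+ (f ∘ fsuc) (g ∘ fsuc)))
        (interchange (f fzero) (g fzero) (sumFin (f ∘ fsuc)) (sumFin (g ∘ fsuc)))

sumFin-neg : ∀ {m} (f : Fin m → ℤ) → sumFin (λ i → - f i) ≡ - sumFin f
sumFin-neg {zero}  f = refl
sumFin-neg {suc m} f =
  trans (cong (_+_ (- f fzero)) (sumFin-neg (f ∘ fsuc)))
        (sym (neg-distrib-+ (f fzero) (sumFin (f ∘ fsuc))))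

-- The hinge graph H_{k,n}: vertices x, y and the internal vertices
-- inner i j (j-th internal vertex, j = 0 .. k-3, of the i-th x–y path).
-- The path i is  x - inner i 0 - inner i 1 - ... - inner i (k-3) - y.

data HV (k n : ℕ) : Set where
  hx hy : HV k n
  inner : Fin n → Fin (k ∸ 2) → HV k n

sumH : ∀ {k n} → (HV k n → ℤ) → ℤ
sumH f = f hx + f hy + sumFin (λ i → sumFin (λ j → f (inner i j)))

adjB : ∀ {k n} → HV k n → HV k n → Bool
adjB hx hx = false
adjB hy hy = false
adjB hx hy = true
adjB hy hx = true
adjB hx (inner i j) = toℕ j ℕ.≡ᵇ 0
adjB (inner i j) hx = toℕ j ℕ.≡ᵇ 0
adjB {k} hy (inner i j) = suc (toℕ j) ℕ.≡ᵇ (k ∸ 2)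
adjB {k} (inner i j) hy = suc (toℕ j) ℕ.≡ᵇ (k ∸ 2)
adjB (inner i j) (inner i' j') =
  (toℕ i ℕ.≡ᵇ toℕ i') ∧
  ((suc (toℕ j) ℕ.≡ᵇ toℕ j') ∨ (suc (toℕ j') ℕ.≡ᵇ toℕ j))

adj : ∀ {k n} → HV k n → HV k n → ℤ
adj u v = if adjB u v then 1ℤ else 0ℤ

Divisor : ℕ → ℕ → Set
Divisor k n = HV k n → ℤ

laplacian : ∀ {k n} → (HV k n → ℤ) → Divisor k n
laplacian f v = sumH (λ u → adj v u * (f v - f u))

Div₀ : ℕ → ℕ → Set
Div₀ k n = Σ (Divisor k n) (λ D → sumH D ≡ 0ℤ)

_∼_ : ∀ {k n} → Div₀ k n → Div₀ k n → Set
_∼_ {k} {n} D E = ∃ λ (f : HV k n → ℤ) → ∀ v → proj₁ D v - proj₁ E v ≡ laplacian f v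

sumFin-cong : ∀ {m} {f g : Fin m → ℤ} → (∀ i → f i ≡ g i) → sumFin f ≡ sumFin g
sumFin-cong {zero}  p = refl
sumFin-cong {suc m} p = cong₂ _+_ (p fzero) (sumFin-cong (p ∘ fsuc))

sumH-+ : ∀ {k n} (f g : HV k n → ℤ) → sumH (λ v → f v + g v) ≡ sumH f + sumH g
sumH-+ {k} {n} f g =
  trans (cong₂ _+_ (interchange (f hx) (g hx) (f hy) (g hy))
                   (trans (sumFin-cong {n} (λ i → sumFin-+ {k ∸ 2} (λ j → f (inner i j))
                                                         (λ j → g (inner i j))))
                          (sumFin-+ {n} _ _)))
        (interchange (f hx + f hy) (g hx + g hy) _ _)

sumH-neg : ∀ {k n} (f : HV k n → ℤ) → sumH (λ v → - f v) ≡ - sumH f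
sumH-neg {k} {n} f =
  trans (cong₂ _+_ (trans (sym (neg-distrib-+ (f hx) (f hy))) refl)
                   (trans (sumFin-cong {n} (λ i → sumFin-neg {k ∸ 2} (λ j → f (inner i j))))
                          (sumFin-neg {n} _)))
        (sym (neg-distrib-+ (f hx + f hy) _))

sumFin-0 : ∀ {m} → sumFin {m} (λ i → 0ℤ) ≡ 0ℤ
sumFin-0 {zero}  = refl
sumFin-0 {suc m} = trans (+-identityˡ _) (sumFin-0 {m})

sumH-0 : ∀ {k n} → sumH {k} {n} (λ v → 0ℤ) ≡ 0ℤ
sumH-0 {k} {n} = trans (+-identityˡ _) (trans (sumFin-cong {n} (λ i → sumFin-0 {k ∸ 2})) (sumFin-0 {n}))

K-Hinge : ℕ → ℕ → RawGroup 0ℓ 0ℓ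
K-Hinge k n = record
  { Carrier = Div₀ k n
  ; _≈_     = _∼_
  ; _∙_     = λ D E → (λ v → proj₁ D v + proj₁ E v) ,
                      trans (sumH-+ (proj₁ D) (proj₁ E)) (cong₂ _+_ (proj₂ D) (proj₂ E))
  ; ε       = (λ v → 0ℤ) , sumH-0 {k} {n}
  ; _⁻¹     = λ D → (λ v → - proj₁ D v) , trans (sumH-neg (proj₁ D)) (cong -_ (proj₂ D))
  }

hingeOrder : ℕ → ℕ → ℤ
hingeOrder k n = + k * + k + + n * + k - + 2 * + k - + n + 1ℤ

Target : ℕ → ℕ → RawGroup 0ℓ 0ℓ
Target k n = record
  { Carrier = (Fin (n ∸ 2) → ℤ) × ℤ
  ; _≈_     = λ a b → (∀ i → (+ k - 1ℤ) ∣ (proj₁ a i - proj₁ b i))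
                      × (hingeOrder k n ∣ (proj₂ a - proj₂ b))
  ; _∙_     = λ a b → (λ i → proj₁ a i + proj₁ b i) , proj₂ a + proj₂ b
  ; ε       = (λ i → 0ℤ) , 0ℤ
  ; _⁻¹     = λ a → (λ i → - proj₁ a i) , - proj₂ a
  }

{-# OPTIONS --safe #-}

-- Let ℓ = k − 1 and, for a divisor D, let A i D = Σ_j (j + 1) D (inner i j) be its first moment
-- along the i-th x–y path. Summation by parts gives A i (L f) = ℓ f(wᵢ) − (ℓ − 1) f(y) − f(x),
-- where wᵢ is the last inner vertex of path i; together with the Laplacian at y this shows that
-- φ₁ t D = A (t+2) D − A 1 D and φ₂ D = Σᵢ A i D + ℓ D(y) − (ℓ + n) A 1 D are divisible by ℓ and
-- by ℓ (ℓ + n) = k² + nk − 2k − n + 1 respectively on principal divisors. Conversely, a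
-- degree-zero divisor F on which they vanish is L f: along each path f is obtained from F by
-- integrating twice, and the initial slopes can be chosen so that every path arrives at the same
-- value at y exactly because φ₁ and φ₂ vanish. Divisors supported next to x realise every value
-- of (φ₁, φ₂), so this pair induces the isomorphism.

module Submission where

open import Defs
open import Data.Nat using (ℕ; _≤_)
open import Data.Product using (∃)
open import Algebra.Morphism.Structures using (module GroupMorphisms)

open import Function using (_∘_)
open import Data.Nat as ℕ using (zero; suc; _<_; z≤n; s≤s; _≡ᵇ_)
import Data.Nat.Properties as ℕ
open import Data.Integer using (ℤ; +_; 0ℤ; 1ℤ; _+_; _-_; _*_; -_)
open import Data.Integer.Properties
  using (+-identityˡ; +-identityʳ; *-identityˡ; *-zeroʳ; *-distribˡ-+; *-distribʳ-+;
         +-inverseˡ; neg-distrib-+; *-comm; i≡j⇒i-j≡0; +-0-abelianGroup)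
open import Data.Integer.Tactic.RingSolver using (solve-∀)
open import Data.Integer.Divisibility using (_∣_)
import Data.Integer.Divisibility.Signed as Signed
open import Data.Fin using (Fin; toℕ) renaming (zero to fzero; suc to fsuc)
open import Data.Fin.Properties using (toℕ<n)
open import Data.Bool using (Bool; true; false; if_then_else_; _∧_; _∨_)
open import Data.Sum using (inj₁; inj₂)
open import Data.Product using (_×_; _,_; proj₁; proj₂)
open import Relation.Binary.PropositionalEquality
open import Algebra.Bundles using (AbelianGroup)
open import Algebra.Bundles.Raw using (RawGroup)
open import Algebra.Properties.Group (AbelianGroup.group +-0-abelianGroup)
  using (identityˡ-unique; inverseˡ-unique)

indicator : Bool → ℤ
indicator b = if b then 1ℤ else 0ℤ

≡ᵇ-sym : ∀ a b → (a ≡ᵇ b) ≡ (b ≡ᵇ a)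
≡ᵇ-sym zero    zero    = refl
≡ᵇ-sym zero    (suc b) = refl
≡ᵇ-sym (suc a) zero    = refl
≡ᵇ-sym (suc a) (suc b) = ≡ᵇ-sym a b

indicator-∧ : ∀ b c x → indicator (b ∧ c) * x ≡ indicator b * (indicator c * x)
indicator-∧ true  c x = sym (*-identityˡ (indicator c * x))
indicator-∧ false c x = refl

indicator-neighbour : ∀ a e →
  indicator ((suc a ≡ᵇ e) ∨ (suc e ≡ᵇ a)) ≡ indicator (suc a ≡ᵇ e) + indicator (suc e ≡ᵇ a)
indicator-neighbour a       zero          = sym (+-identityˡ _)
indicator-neighbour zero    (suc zero)    = refl
indicator-neighbour zero    (suc (suc e)) = refl
indicator-neighbour (suc a) (suc e)       = indicator-neighbour a e

multiple⇒∣ : ∀ {d x} q → x ≡ q * d → d ∣ x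
multiple⇒∣ q eq = Signed.∣⇒∣ᵤ (Signed.divides q eq)

∣⇒multiple : ∀ {d x} → d ∣ x → ∃ λ q → x ≡ q * d
∣⇒multiple d∣x with Signed.∣ᵤ⇒∣ d∣x
... | Signed.divides q eq = q , eq

extend : ∀ {m} → (Fin m → ℤ) → ℤ → ℕ → ℤ
extend {zero}  h d p       = d
extend {suc m} h d zero    = h fzero
extend {suc m} h d (suc p) = extend (h ∘ fsuc) d p

extend-toℕ : ∀ {m} (h : Fin m → ℤ) d (j : Fin m) → extend h d (toℕ j) ≡ h j
extend-toℕ h d fzero    = refl
extend-toℕ h d (fsuc j) = extend-toℕ (h ∘ fsuc) d j

extend-≥ : ∀ {m} (h : Fin m → ℤ) d p → m ≤ p → extend h d p ≡ d
extend-≥ {zero}  h d p       _         = refl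
extend-≥ {suc m} h d (suc p) (s≤s m≤p) = extend-≥ (h ∘ fsuc) d p m≤p

extend-tabulate : ∀ {m} (G : ℕ → ℤ) d p → p < m → extend {m} (G ∘ toℕ) d p ≡ G p
extend-tabulate {suc m} G d zero    _         = refl
extend-tabulate {suc m} G d (suc p) (s≤s p<m) = extend-tabulate {m} (G ∘ suc) d p p<m

extend-∘ : ∀ {m} (g : ℤ → ℤ) (h : Fin m → ℤ) d p → extend (g ∘ h) (g d) p ≡ g (extend h d p)
extend-∘ {zero}  g h d p       = refl
extend-∘ {suc m} g h d zero    = refl
extend-∘ {suc m} g h d (suc p) = extend-∘ g (h ∘ fsuc) d p

extend-irrelevant : ∀ {m} (h : Fin m → ℤ) d d′ p → p < m → extend h d p ≡ extend h d′ p
extend-irrelevant {suc m} h d d′ zero    _         = refl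
extend-irrelevant {suc m} h d d′ (suc p) (s≤s p<m) = extend-irrelevant (h ∘ fsuc) d d′ p p<m

extend-sub-below : ∀ {m} c (h : Fin m → ℤ) d p → p < m →
                   extend (λ j → c - h j) 0ℤ p ≡ c - extend h d p
extend-sub-below c h d p p<m =
  trans (extend-irrelevant (λ j → c - h j) 0ℤ (c - d) p p<m) (extend-∘ (λ x → c - x) h d p)

extend-boundary : ∀ {m} (h : Fin m → ℤ) d p → p ≤ m →
                  indicator (p ≡ᵇ m) * d + extend h 0ℤ p ≡ extend h d p
extend-boundary {zero}  h d zero    _         = trans (+-identityʳ (1ℤ * d)) (*-identityˡ d)
extend-boundary {suc m} h d zero    _         = +-identityˡ (h fzero)
extend-boundary {suc m} h d (suc p) (s≤s p≤m) = extend-boundary (h ∘ fsuc) d p p≤m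

sumFin-*ˡ : ∀ {m} a (g : Fin m → ℤ) → sumFin (λ j → a * g j) ≡ a * sumFin g
sumFin-*ˡ {zero}  a g = sym (*-zeroʳ a)
sumFin-*ˡ {suc m} a g = trans (cong (λ s → a * g fzero + s) (sumFin-*ˡ a (g ∘ fsuc)))
                              (sym (*-distribˡ-+ a (g fzero) (sumFin (g ∘ fsuc))))

sumFin-const : ∀ m c → sumFin {m} (λ _ → c) ≡ + m * c
sumFin-const zero    c = refl
sumFin-const (suc m) c = trans (cong (_+_ c) (sumFin-const m c)) (identity c (+ m))
  where identity : ∀ c x → c + x * c ≡ (1ℤ + x) * c
        identity = solve-∀

sumFin-affine : ∀ {m} a b (u : Fin m → ℤ) → sumFin (λ i → a * u i + b) ≡ a * sumFin u + + m * b
sumFin-affine {m} a b u = trans (sumFin-+ (λ i → a * u i) (λ _ → b))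
                                (cong₂ _+_ (sumFin-*ˡ a u) (sumFin-const m b))

sumFin-head : ∀ {m} (g : Fin (suc m) → ℤ) → (∀ j → g (fsuc j) ≡ 0ℤ) → sumFin g ≡ g fzero
sumFin-head {m} g tail≡0 =
  trans (cong (_+_ (g fzero)) (trans (sumFin-cong tail≡0) (sumFin-0 {m}))) (+-identityʳ (g fzero))

sumFin-select : ∀ {m} a (g : Fin m → ℤ) →
                sumFin (λ j → indicator (toℕ j ≡ᵇ a) * g j) ≡ extend g 0ℤ a
sumFin-select {zero}  a       g = refl
sumFin-select {suc m} zero    g =
  trans (cong (λ s → 1ℤ * g fzero + s) (sumFin-0 {m})) (trans (+-identityʳ _) (*-identityˡ (g fzero)))
sumFin-select {suc m} (suc a) g = trans (+-identityˡ _) (sumFin-select a (g ∘ fsuc))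

sumFin-select′ : ∀ {m} a (g : Fin m → ℤ) →
                 sumFin (λ j → indicator (a ≡ᵇ toℕ j) * g j) ≡ extend g 0ℤ a
sumFin-select′ a g =
  trans (sumFin-cong (λ j → cong (λ b → indicator b * g j) (≡ᵇ-sym a (toℕ j)))) (sumFin-select a g)

sumFin-indicator-∧ : ∀ {m} b (c : Fin m → Bool) (g : Fin m → ℤ) →
  sumFin (λ j → indicator (b ∧ c j) * g j) ≡ indicator b * sumFin (λ j → indicator (c j) * g j)
sumFin-indicator-∧ b c g =
  trans (sumFin-cong (λ j → indicator-∧ b (c j) (g j)))
        (sumFin-*ˡ (indicator b) (λ j → indicator (c j) * g j))

sumFin-select-toℕ : ∀ {m} (i : Fin m) (g : Fin m → ℤ) →
                    sumFin (λ j → indicator (toℕ i ≡ᵇ toℕ j) * g j) ≡ g i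
sumFin-select-toℕ i g = trans (sumFin-select′ (toℕ i) g) (extend-toℕ g 0ℤ i)

Δ² : (ℕ → ℤ) → ℕ → ℤ
Δ² P e = (P (suc e) - P e) + (P (suc e) - P (suc (suc e)))

Δ²-cong : ∀ {P P′ : ℕ → ℤ} e → P e ≡ P′ e → P (suc e) ≡ P′ (suc e) →
          P (suc (suc e)) ≡ P′ (suc (suc e)) → Δ² P e ≡ Δ² P′ e
Δ²-cong e p₀ p₁ p₂ = cong₂ _+_ (cong₂ _-_ p₁ p₀) (cong₂ _-_ p₁ p₂)

sumFin-Δ² : ∀ p (P : ℕ → ℤ) →
            sumFin {p} (λ j → Δ² P (toℕ j)) ≡ (P 1 - P 0) - (P (suc p) - P p)
sumFin-Δ² zero    P = identity (P 0) (P 1)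
  where identity : ∀ a b → 0ℤ ≡ (b - a) - (b - a)
        identity = solve-∀
sumFin-Δ² (suc p) P =
  trans (cong (_+_ (Δ² P 0)) (sumFin-Δ² p (P ∘ suc)))
        (identity (P 0) (P 1) (P 2) (P (suc p)) (P (suc (suc p))))
  where identity : ∀ a b c y z → ((b - a) + (b - c)) + ((c - b) - (z - y)) ≡ (b - a) - (z - y)
        identity = solve-∀

sumFin-weighted-Δ² : ∀ p (P : ℕ → ℤ) →
  sumFin {p} (λ j → + suc (toℕ j) * Δ² P (toℕ j)) ≡ + suc p * P p - + p * P (suc p) - P 0
sumFin-weighted-Δ² zero    P = identity (P 0) (P 1)
  where identity : ∀ a b → 0ℤ ≡ 1ℤ * a - 0ℤ * b - a
        identity = solve-∀
sumFin-weighted-Δ² (suc p) P = begin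
  1ℤ * Δ² P 0 + sumFin {p} (λ j → + suc (suc (toℕ j)) * Δ² Q (toℕ j))
    ≡⟨ cong (_+_ (1ℤ * Δ² P 0)) (trans (sumFin-cong {p} (λ j → split (+ suc (toℕ j)) (Δ² Q (toℕ j))))
                                        (sumFin-+ {p} (λ j → + suc (toℕ j) * Δ² Q (toℕ j)) _)) ⟩
  1ℤ * Δ² P 0 + (sumFin {p} (λ j → + suc (toℕ j) * Δ² Q (toℕ j))
                 + sumFin {p} (λ j → Δ² Q (toℕ j)))
    ≡⟨ cong₂ (λ w s → 1ℤ * Δ² P 0 + (w + s)) (sumFin-weighted-Δ² p Q) (sumFin-Δ² p Q) ⟩
  1ℤ * Δ² P 0 + ((+ suc p * P (suc p) - + p * P (suc (suc p)) - P 1)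
                 + ((P 2 - P 1) - (P (suc (suc p)) - P (suc p))))
    ≡⟨ identity (+ p) (P 0) (P 1) (P 2) (P (suc p)) (P (suc (suc p))) ⟩
  + suc (suc p) * P (suc p) - + suc p * P (suc (suc p)) - P 0 ∎
  where
  open ≡-Reasoning
  Q : ℕ → ℤ
  Q = P ∘ suc
  split : ∀ x d → (1ℤ + x) * d ≡ x * d + d
  split = solve-∀
  identity : ∀ x a b c y z →
    1ℤ * ((b - a) + (b - c)) + (((1ℤ + x) * y - x * z - b) + ((c - b) - (z - y)))
    ≡ (1ℤ + (1ℤ + x)) * y - (1ℤ + x) * z - a
  identity = solve-∀

integrate : ℤ → (ℕ → ℤ) → ℕ → ℤ
integrate c d zero          = 0ℤ
integrate c d (suc zero)    = c
integrate c d (suc (suc e)) = integrate c d (suc e) + (integrate c d (suc e) - integrate c d e) - d e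

Δ²-integrate : ∀ c d e → Δ² (integrate c d) e ≡ d e
Δ²-integrate c d e = identity (integrate c d (suc e)) (integrate c d e) (d e)
  where identity : ∀ a b x → (a - b) + (a - (a + (a - b) - x)) ≡ x
        identity = solve-∀

record IsLinear {X : Set} (ψ : (X → ℤ) → ℤ) : Set where
  field
    cong-≗ : ∀ {D E} → (∀ v → D v ≡ E v) → ψ D ≡ ψ E
    +-homo : ∀ D E → ψ (λ v → D v + E v) ≡ ψ D + ψ E

  0-homo : ψ (λ _ → 0ℤ) ≡ 0ℤ
  0-homo = identityˡ-unique _ _ (sym (+-homo (λ _ → 0ℤ) (λ _ → 0ℤ)))

  -‿homo : ∀ D → ψ (λ v → - D v) ≡ - ψ D
  -‿homo D = inverseˡ-unique _ _
    (trans (sym (+-homo (λ v → - D v) D)) (trans (cong-≗ (λ v → +-inverseˡ (D v))) 0-homo))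

  sub-homo : ∀ D E → ψ (λ v → D v - E v) ≡ ψ D - ψ E
  sub-homo D E = trans (+-homo D (λ v → - E v)) (cong (_+_ (ψ D)) (-‿homo E))

module _ {X : Set} where

  eval-linear : (v : X) → IsLinear (λ D → D v)
  eval-linear v = record { cong-≗ = λ D≗E → D≗E v ; +-homo = λ D E → refl }

  scale-linear : ∀ a {ψ : (X → ℤ) → ℤ} → IsLinear ψ → IsLinear (λ D → a * ψ D)
  scale-linear a ψ-lin = record
    { cong-≗ = λ D≗E → cong (a *_) (cong-≗ D≗E)
    ; +-homo = λ D E → trans (cong (a *_) (+-homo D E)) (*-distribˡ-+ a _ _) }
    where open IsLinear ψ-lin

  +-linear : ∀ {ψ χ : (X → ℤ) → ℤ} → IsLinear ψ → IsLinear χ → IsLinear (λ D → ψ D + χ D)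
  +-linear {ψ} {χ} ψ-lin χ-lin = record
    { cong-≗ = λ D≗E → cong₂ _+_ (Ψ.cong-≗ D≗E) (Χ.cong-≗ D≗E)
    ; +-homo = λ D E → trans (cong₂ _+_ (Ψ.+-homo D E) (Χ.+-homo D E))
                             (interchange (ψ D) (ψ E) (χ D) (χ E)) }
    where
    module Ψ = IsLinear ψ-lin
    module Χ = IsLinear χ-lin
    interchange : ∀ a b c d → (a + b) + (c + d) ≡ (a + c) + (b + d)
    interchange = solve-∀

  neg-linear : ∀ {ψ : (X → ℤ) → ℤ} → IsLinear ψ → IsLinear (λ D → - ψ D)
  neg-linear {ψ} ψ-lin = record
    { cong-≗ = λ D≗E → cong -_ (cong-≗ D≗E)
    ; +-homo = λ D E → trans (cong -_ (+-homo D E)) (neg-distrib-+ (ψ D) (ψ E)) }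
    where open IsLinear ψ-lin

  sub-linear : ∀ {ψ χ : (X → ℤ) → ℤ} → IsLinear ψ → IsLinear χ → IsLinear (λ D → ψ D - χ D)
  sub-linear ψ-lin χ-lin = +-linear ψ-lin (neg-linear χ-lin)

  sumFin-linear : ∀ {m} {ψ : Fin m → (X → ℤ) → ℤ} →
                  (∀ i → IsLinear (ψ i)) → IsLinear (λ D → sumFin (λ i → ψ i D))
  sumFin-linear {ψ = ψ} ψ-lin = record
    { cong-≗ = λ D≗E → sumFin-cong (λ i → IsLinear.cong-≗ (ψ-lin i) D≗E)
    ; +-homo = λ D E → trans (sumFin-cong (λ i → IsLinear.+-homo (ψ-lin i) D E))
                             (sumFin-+ (λ i → ψ i D) (λ i → ψ i E)) }

-- walk f i p is the value of f at the p-th vertex of the path x → inner i 0 → ⋯ → y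
walk : ∀ {m n} → (HV (suc (suc m)) n → ℤ) → Fin n → ℕ → ℤ
walk f i zero    = f hx
walk f i (suc p) = extend (λ j → f (inner i j)) (f hy) p

walk-end : ∀ {m n} (f : HV (suc (suc m)) n → ℤ) i → walk f i (suc m) ≡ f hy
walk-end {m} f i = extend-≥ (λ j → f (inner i j)) (f hy) m ℕ.≤-refl

laplacian-hx : ∀ {m n} (f : HV (suc (suc (suc m))) n → ℤ) →
               laplacian f hx ≡ (f hx - f hy) + sumFin (λ i → f hx - walk f i 1)
laplacian-hx f = cong₂ _+_
  (trans (+-identityˡ _) (*-identityˡ (f hx - f hy)))
  (sumFin-cong (λ i → sumFin-select 0 (λ j → f hx - f (inner i j))))

laplacian-hy : ∀ {m n} (f : HV (suc (suc (suc m))) n → ℤ) →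
               laplacian f hy ≡ (f hy - f hx) + sumFin (λ i → f hy - walk f i (suc m))
laplacian-hy {m} f = cong₂ _+_
  (trans (+-identityʳ _) (*-identityˡ (f hy - f hx)))
  (sumFin-cong (λ i → trans (sumFin-select m (λ j → f hy - f (inner i j)))
                            (extend-sub-below (f hy) (λ j → f (inner i j)) (f hy) m (ℕ.n<1+n m))))

walk-predecessor : ∀ {m n} (f : HV (suc (suc m)) n → ℤ) i (j : Fin m) →
  indicator (toℕ j ≡ᵇ 0) * (f (inner i j) - f hx)
    + sumFin (λ j′ → indicator (suc (toℕ j′) ≡ᵇ toℕ j) * (f (inner i j) - f (inner i j′)))
  ≡ f (inner i j) - walk f i (toℕ j)
walk-predecessor {suc m} f i fzero =
  trans (cong (_+_ (1ℤ * (f (inner i fzero) - f hx))) (sumFin-0 {suc m}))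
        (trans (+-identityʳ _) (*-identityˡ _))
walk-predecessor {suc m} f i (fsuc j) =
  trans (+-identityˡ _)
        (trans (sumFin-select (toℕ j) (λ j′ → c - f (inner i j′)))
               (extend-sub-below c (λ j′ → f (inner i j′)) (f hy) (toℕ j) (ℕ.m<n⇒m<1+n (toℕ<n j))))
  where
  c : ℤ
  c = f (inner i (fsuc j))

walk-successor : ∀ {m n} (f : HV (suc (suc m)) n → ℤ) i (j : Fin m) →
  indicator (suc (toℕ j) ≡ᵇ m) * (f (inner i j) - f hy)
    + sumFin (λ j′ → indicator (suc (toℕ j) ≡ᵇ toℕ j′) * (f (inner i j) - f (inner i j′)))
  ≡ f (inner i j) - walk f i (suc (suc (toℕ j)))
walk-successor {m} f i j =
  trans (cong (_+_ (indicator (suc (toℕ j) ≡ᵇ m) * (c - f hy))) (sumFin-select′ (suc (toℕ j)) g))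
        (trans (extend-boundary g (c - f hy) (suc (toℕ j)) (toℕ<n j))
               (extend-∘ (λ x → c - x) (λ j′ → f (inner i j′)) (f hy) (suc (toℕ j))))
  where
  c : ℤ
  c = f (inner i j)
  g : Fin m → ℤ
  g j′ = c - f (inner i j′)

laplacian-inner : ∀ {m n} (f : HV (suc (suc m)) n → ℤ) i j →
                  laplacian f (inner i j) ≡ Δ² (walk f i) (toℕ j)
laplacian-inner {m} {n} f i j = begin
  laplacian f (inner i j)
    ≡⟨ cong (_+_ (toX + toY)) (trans (sumFin-cong onPath) (sumFin-select-toℕ i row)) ⟩
  (toX + toY) + row i
    ≡⟨ cong (_+_ (toX + toY)) (trans (sumFin-cong split) (sumFin-+ successor predecessor)) ⟩
  (toX + toY) + (sumFin successor + sumFin predecessor)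
    ≡⟨ interchange toX toY (sumFin successor) (sumFin predecessor) ⟩
  (toX + sumFin predecessor) + (toY + sumFin successor)
    ≡⟨ cong₂ _+_ (walk-predecessor f i j) (walk-successor f i j) ⟩
  (c - walk f i a) + (c - walk f i (suc (suc a)))
    ≡⟨ cong (λ z → (z - walk f i a) + (z - walk f i (suc (suc a))))
            (sym (extend-toℕ (λ j′ → f (inner i j′)) (f hy) j)) ⟩
  Δ² (walk f i) a ∎
  where
  open ≡-Reasoning
  a : ℕ
  a = toℕ j
  c : ℤ
  c = f (inner i j)
  toX toY : ℤ
  toX = indicator (a ≡ᵇ 0) * (c - f hx)
  toY = indicator (suc a ≡ᵇ m) * (c - f hy)
  neighbour : Fin m → Bool
  neighbour j′ = (suc a ≡ᵇ toℕ j′) ∨ (suc (toℕ j′) ≡ᵇ a)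
  row : Fin n → ℤ
  row i′ = sumFin (λ j′ → indicator (neighbour j′) * (c - f (inner i′ j′)))
  successor predecessor : Fin m → ℤ
  successor j′   = indicator (suc a ≡ᵇ toℕ j′) * (c - f (inner i j′))
  predecessor j′ = indicator (suc (toℕ j′) ≡ᵇ a) * (c - f (inner i j′))

  onPath : ∀ i′ → sumFin (λ j′ → indicator ((toℕ i ≡ᵇ toℕ i′) ∧ neighbour j′) * (c - f (inner i′ j′)))
                ≡ indicator (toℕ i ≡ᵇ toℕ i′) * row i′
  onPath i′ = sumFin-indicator-∧ (toℕ i ≡ᵇ toℕ i′) neighbour (λ j′ → c - f (inner i′ j′))

  split : ∀ j′ → indicator (neighbour j′) * (c - f (inner i j′)) ≡ successor j′ + predecessor j′
  split j′ = trans (cong (_* (c - f (inner i j′))) (indicator-neighbour a (toℕ j′)))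
                   (*-distribʳ-+ (c - f (inner i j′)) (indicator (suc a ≡ᵇ toℕ j′))
                                 (indicator (suc (toℕ j′) ≡ᵇ a)))

  interchange : ∀ p q r s → (p + q) + (r + s) ≡ (p + s) + (q + r)
  interchange = solve-∀

moment : ∀ {m n} → (HV (suc (suc m)) n → ℤ) → Fin n → ℤ
moment D i = sumFin (λ j → + suc (toℕ j) * D (inner i j))

moment-linear : ∀ {m n} (i : Fin n) → IsLinear (λ (D : HV (suc (suc m)) n → ℤ) → moment D i)
moment-linear i = sumFin-linear (λ j → scale-linear (+ suc (toℕ j)) (eval-linear (inner i j)))

moment-head : ∀ {m n} (D : HV (suc (suc (suc m))) n → ℤ) i →
              (∀ j → D (inner i (fsuc j)) ≡ 0ℤ) → moment D i ≡ D (inner i fzero)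
moment-head D i tail≡0 =
  trans (sumFin-head (λ j → + suc (toℕ j) * D (inner i j))
                     (λ j → trans (cong (+ suc (suc (toℕ j)) *_) (tail≡0 j)) (*-zeroʳ (+ suc (suc (toℕ j))))))
        (*-identityˡ (D (inner i fzero)))

moment-laplacian : ∀ {m n} (f : HV (suc (suc m)) n → ℤ) i →
                   moment (laplacian f) i ≡ + suc m * walk f i m - + m * f hy - f hx
moment-laplacian {m} f i = begin
  moment (laplacian f) i
    ≡⟨ sumFin-cong (λ j → cong (+ suc (toℕ j) *_) (laplacian-inner f i j)) ⟩
  sumFin {m} (λ j → + suc (toℕ j) * Δ² (walk f i) (toℕ j))
    ≡⟨ sumFin-weighted-Δ² m (walk f i) ⟩
  + suc m * walk f i m - + m * walk f i (suc m) - f hx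
    ≡⟨ cong (λ y → + suc m * walk f i m - + m * y - f hx) (walk-end f i) ⟩
  + suc m * walk f i m - + m * f hy - f hx ∎
  where open ≡-Reasoning

Principal : ∀ {k n} → (HV k n → ℤ) → Set
Principal {k} {n} F = ∃ λ (f : HV k n → ℤ) → ∀ v → F v ≡ laplacian f v

module Potential {m n : ℕ} (F : HV (suc (suc (suc m))) n → ℤ) (Y : ℤ) (Q : Fin n → ℤ)
                 (slope : ∀ i → + suc (suc m) * Q i ≡ Y - moment F i) where

  open ≡-Reasoning

  M : ℕ
  M = suc m

  S : Fin n → ℤ
  S i = sumFin (λ j → F (inner i j))

  P : Fin n → ℕ → ℤ
  P i = integrate (S i + Q i) (extend (λ j → F (inner i j)) 0ℤ)

  potential : HV (suc (suc M)) n → ℤ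
  potential hx          = 0ℤ
  potential hy          = Y
  potential (inner i j) = P i (suc (toℕ j))

  Δ²-P : ∀ i j → Δ² (P i) (toℕ j) ≡ F (inner i j)
  Δ²-P i j = trans (Δ²-integrate _ _ (toℕ j)) (extend-toℕ (λ j′ → F (inner i j′)) 0ℤ j)

  P-last-step : ∀ i → P i (suc M) - P i M ≡ Q i
  P-last-step i = cancel (S i) (Q i) (P i (suc M) - P i M) (begin
    S i                                         ≡⟨ sumFin-cong (λ j → sym (Δ²-P i j)) ⟩
    sumFin {M} (λ j → Δ² (P i) (toℕ j))         ≡⟨ sumFin-Δ² M (P i) ⟩
    (S i + Q i - 0ℤ) - (P i (suc M) - P i M)    ∎)
    where
    cancel : ∀ s q x → s ≡ (s + q - 0ℤ) - x → x ≡ q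
    cancel s q x eq = trans (identity s q x) (trans (cong (λ z → q + (s - z)) (sym eq)) (collapse q s))
      where identity : ∀ s q x → x ≡ q + (s - ((s + q - 0ℤ) - x))
            identity = solve-∀
            collapse : ∀ q s → q + (s - s) ≡ q
            collapse = solve-∀

  P-end : ∀ i → P i (suc M) ≡ Y
  P-end i = begin
    P i (suc M)
      ≡⟨ identity (+ M) (P i M) (P i (suc M)) ⟩
    (1ℤ + + M) * (P i (suc M) - P i M) + (+ suc M * P i M - + M * P i (suc M) - 0ℤ)
      ≡⟨ cong₂ (λ q a → (1ℤ + + M) * q + a) (P-last-step i) (sym moment-P) ⟩
    + suc M * Q i + moment F i
      ≡⟨ cong (_+ moment F i) (slope i) ⟩
    (Y - moment F i) + moment F i
      ≡⟨ cancelʳ Y (moment F i) ⟩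
    Y ∎
    where
    cancelʳ : ∀ y a → (y - a) + a ≡ y
    cancelʳ = solve-∀
    identity : ∀ x a b → b ≡ (1ℤ + x) * (b - a) + ((1ℤ + x) * a - x * b - 0ℤ)
    identity = solve-∀
    moment-P : moment F i ≡ + suc M * P i M - + M * P i (suc M) - 0ℤ
    moment-P = trans (sumFin-cong (λ j → cong (+ suc (toℕ j) *_) (sym (Δ²-P i j))))
                     (sumFin-weighted-Δ² M (P i))

  walk-potential : ∀ i p → p ≤ suc M → walk potential i p ≡ P i p
  walk-potential i zero    _         = refl
  walk-potential i (suc p) (s≤s p≤M) with ℕ.m≤n⇒m<n∨m≡n p≤M
  ... | inj₁ p<M = extend-tabulate {M} (λ e → P i (suc e)) Y p p<M
  ... | inj₂ refl = trans (walk-end potential i) (sym (P-end i))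

  laplacian-potential-inner : ∀ i j → F (inner i j) ≡ laplacian potential (inner i j)
  laplacian-potential-inner i j = sym (begin
    laplacian potential (inner i j)  ≡⟨ laplacian-inner potential i j ⟩
    Δ² (walk potential i) (toℕ j)    ≡⟨ Δ²-cong {walk potential i} {P i} (toℕ j)
                                          (walk-potential i _ (ℕ.m≤n⇒m≤1+n (ℕ.<⇒≤ j<M)))
                                          (walk-potential i _ (s≤s (ℕ.<⇒≤ j<M)))
                                          (walk-potential i _ (s≤s j<M)) ⟩
    Δ² (P i) (toℕ j)                 ≡⟨ Δ²-P i j ⟩
    F (inner i j)                    ∎)
    where
    j<M : toℕ j < M
    j<M = toℕ<n j

  module _ (degree : sumH F ≡ 0ℤ) (flux : sumFin Q ≡ F hy - Y) where

    laplacian-potential-hx : F hx ≡ laplacian potential hx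
    laplacian-potential-hx = sym (begin
      laplacian potential hx
        ≡⟨ laplacian-hx potential ⟩
      (0ℤ - Y) + sumFin (λ i → 0ℤ - (S i + Q i))
        ≡⟨ cong (_+_ (0ℤ - Y)) (trans (sumFin-cong (λ i → +-identityˡ (- (S i + Q i))))
                                      (trans (sumFin-neg (λ i → S i + Q i)) (cong -_ (sumFin-+ S Q)))) ⟩
      (0ℤ - Y) + - (sumFin S + sumFin Q)
        ≡⟨ cong (λ q → (0ℤ - Y) + - (sumFin S + q)) flux ⟩
      (0ℤ - Y) + - (sumFin S + (F hy - Y))
        ≡⟨ identity (F hx) (F hy) (sumFin S) Y ⟩
      F hx - sumH F
        ≡⟨ cong (_-_ (F hx)) degree ⟩
      F hx - 0ℤ
        ≡⟨ +-identityʳ (F hx) ⟩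
      F hx ∎)
      where identity : ∀ x y s z → (0ℤ - z) + - (s + (y - z)) ≡ x - (x + y + s)
            identity = solve-∀

    laplacian-potential-hy : F hy ≡ laplacian potential hy
    laplacian-potential-hy = sym (begin
      laplacian potential hy
        ≡⟨ laplacian-hy potential ⟩
      (Y - 0ℤ) + sumFin (λ i → Y - walk potential i M)
        ≡⟨ cong (_+_ (Y - 0ℤ)) (sumFin-cong (λ i →
             trans (cong₂ _-_ (sym (P-end i)) (walk-potential i M (ℕ.n≤1+n M))) (P-last-step i))) ⟩
      (Y - 0ℤ) + sumFin Q
        ≡⟨ cong (_+_ (Y - 0ℤ)) flux ⟩
      (Y - 0ℤ) + (F hy - Y)
        ≡⟨ identity Y (F hy) ⟩
      F hy ∎)
      where identity : ∀ z y → (z - 0ℤ) + (y - z) ≡ y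
            identity = solve-∀

    principal : Principal F
    principal = potential , λ { hx → laplacian-potential-hx
                              ; hy → laplacian-potential-hy
                              ; (inner i j) → laplacian-potential-inner i j }

module Invariants (m₀ n₀ : ℕ) where

  open ≡-Reasoning

  k n M : ℕ
  k = suc (suc (suc m₀))
  n = suc (suc n₀)
  M = suc m₀

  V : Set
  V = HV k n

  ℓ ν : ℤ
  ℓ = + suc M
  ν = + n

  i₁ : Fin n
  i₁ = fsuc fzero

  φ₁ : Fin n₀ → (V → ℤ) → ℤ
  φ₁ t D = moment D (fsuc (fsuc t)) - moment D i₁

  φ₂ : (V → ℤ) → ℤ
  φ₂ D = sumFin (moment D) + ℓ * D hy - (ℓ + ν) * moment D i₁

  φ₁-linear : ∀ t → IsLinear (φ₁ t)
  φ₁-linear t = sub-linear (moment-linear (fsuc (fsuc t))) (moment-linear i₁)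

  φ₂-linear : IsLinear φ₂
  φ₂-linear = sub-linear (+-linear (sumFin-linear moment-linear) (scale-linear ℓ (eval-linear hy)))
                         (scale-linear (ℓ + ν) (moment-linear i₁))

  Vanishes : (V → ℤ) → Set
  Vanishes F = (∀ t → ∃ λ q → φ₁ t F ≡ q * ℓ) × (∃ λ r → φ₂ F ≡ r * (ℓ * (ℓ + ν)))

  vanishes-≗ : ∀ {F G} → (∀ v → F v ≡ G v) → Vanishes G → Vanishes F
  vanishes-≗ F≗G (q , r) =
    (λ t → proj₁ (q t) , trans (IsLinear.cong-≗ (φ₁-linear t) F≗G) (proj₂ (q t))) ,
    (proj₁ r , trans (IsLinear.cong-≗ φ₂-linear F≗G) (proj₂ r))

  φ₁-laplacian : ∀ f t → φ₁ t (laplacian f) ≡ (walk f (fsuc (fsuc t)) M - walk f i₁ M) * ℓ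
  φ₁-laplacian f t =
    trans (cong₂ _-_ (moment-laplacian f (fsuc (fsuc t))) (moment-laplacian f i₁))
          (identity ℓ (+ M) (f hy) (f hx) (walk f (fsuc (fsuc t)) M) (walk f i₁ M))
    where identity : ∀ l μ y x w w′ → (l * w - μ * y - x) - (l * w′ - μ * y - x) ≡ (w - w′) * l
          identity = solve-∀

  φ₂-laplacian : ∀ f → φ₂ (laplacian f) ≡ (f hy - walk f i₁ M) * (ℓ * (ℓ + ν))
  φ₂-laplacian f = begin
    sumFin (moment (laplacian f)) + ℓ * laplacian f hy - (ℓ + ν) * moment (laplacian f) i₁
      ≡⟨ cong₂ (λ s y → s + ℓ * y - (ℓ + ν) * moment (laplacian f) i₁) sum-moments hy-value ⟩
    (ℓ * sumFin w + ν * (- (μ * f hy) - f hx)) + ℓ * ((f hy - f hx) + (- 1ℤ * sumFin w + ν * f hy))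
      - (ℓ + ν) * moment (laplacian f) i₁
      ≡⟨ cong (λ a → (ℓ * sumFin w + ν * (- (μ * f hy) - f hx))
                     + ℓ * ((f hy - f hx) + (- 1ℤ * sumFin w + ν * f hy)) - (ℓ + ν) * a)
              (moment-laplacian f i₁) ⟩
    (ℓ * sumFin w + ν * (- (μ * f hy) - f hx)) + ℓ * ((f hy - f hx) + (- 1ℤ * sumFin w + ν * f hy))
      - (ℓ + ν) * (ℓ * w i₁ - μ * f hy - f hx)
      ≡⟨ identity μ ν (sumFin w) (w i₁) (f hx) (f hy) ⟩
    (f hy - w i₁) * (ℓ * (ℓ + ν)) ∎
    where
    μ : ℤ
    μ = + M
    w : Fin n → ℤ
    w i = walk f i M
    sum-moments : sumFin (moment (laplacian f)) ≡ ℓ * sumFin w + ν * (- (μ * f hy) - f hx)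
    sum-moments = trans (sumFin-cong (λ i → trans (moment-laplacian f i) (regroup ℓ μ (f hy) (f hx) (w i))))
                        (sumFin-affine ℓ (- (μ * f hy) - f hx) w)
      where regroup : ∀ l μ y x a → l * a - μ * y - x ≡ l * a + (- (μ * y) - x)
            regroup = solve-∀
    hy-value : laplacian f hy ≡ (f hy - f hx) + (- 1ℤ * sumFin w + ν * f hy)
    hy-value = trans (laplacian-hy f)
                     (cong (_+_ (f hy - f hx)) (trans (sumFin-cong (λ i → regroup (f hy) (w i)))
                                                      (sumFin-affine (- 1ℤ) (f hy) w)))
      where regroup : ∀ y a → y - a ≡ - 1ℤ * a + y
            regroup = solve-∀
    identity : ∀ μ ν s a x y →
      ((1ℤ + μ) * s + ν * (- (μ * y) - x)) + (1ℤ + μ) * ((y - x) + (- 1ℤ * s + ν * y))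
        - ((1ℤ + μ) + ν) * ((1ℤ + μ) * a - μ * y - x)
      ≡ (y - a) * ((1ℤ + μ) * ((1ℤ + μ) + ν))
    identity = solve-∀

  laplacian-vanishes : ∀ f → Vanishes (laplacian f)
  laplacian-vanishes f = (λ t → walk f (fsuc (fsuc t)) M - walk f i₁ M , φ₁-laplacian f t)
                       , (f hy - walk f i₁ M , φ₂-laplacian f)

  -- The slope condition on path 0 is where φ₂ F ≡ 0 (mod ℓ (ℓ + ν)) is needed.
  vanishing-slopes : ∀ (F : V → ℤ) → Vanishes F →
    ∃ λ Y → ∃ λ (Q : Fin n → ℤ) → (∀ i → ℓ * Q i ≡ Y - moment F i) × (sumFin Q ≡ F hy - Y)
  vanishing-slopes F (quotients , r , φ₂F≡) = Y , Q , slope , flux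
    where
    A : Fin n → ℤ
    A = moment F
    q : Fin n₀ → ℤ
    q t = proj₁ (quotients t)
    Y : ℤ
    Y = A i₁ + ℓ * r
    Q : Fin n → ℤ
    Q fzero            = (F hy - Y) - (r + sumFin (λ t → r - q t))
    Q (fsuc fzero)     = r
    Q (fsuc (fsuc t))  = r - q t

    flux : sumFin Q ≡ F hy - Y
    flux = cancelʳ (F hy - Y) (r + sumFin (λ t → r - q t))
      where cancelʳ : ∀ a b → (a - b) + b ≡ a
            cancelʳ = solve-∀

    other-moment : ∀ t → A (fsuc (fsuc t)) ≡ ℓ * q t + A i₁
    other-moment t = trans (shift (A (fsuc (fsuc t))) (A i₁))
                           (cong (λ d → d + A i₁) (trans (proj₂ (quotients t)) (*-comm (q t) ℓ)))
      where shift : ∀ a b → a ≡ (a - b) + b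
            shift = solve-∀

    slope : ∀ i → ℓ * Q i ≡ Y - A i
    slope fzero = begin
      ℓ * ((F hy - Y) - (r + sumFin (λ t → r - q t)))
        ≡⟨ cong (λ s → ℓ * ((F hy - Y) - (r + s)))
                (trans (sumFin-cong (λ t → negate r (q t))) (sumFin-affine (- 1ℤ) r q)) ⟩
      ℓ * ((F hy - Y) - (r + (- 1ℤ * sumFin q + + n₀ * r)))
        ≡⟨ identity ℓ (+ n₀) (A fzero) (A i₁) (F hy) r (sumFin q) ⟩
      (Y - A fzero) + ((A fzero + (A i₁ + (ℓ * sumFin q + + n₀ * A i₁)) + ℓ * F hy - (ℓ + ν) * A i₁)
                       - r * (ℓ * (ℓ + ν)))
        ≡⟨ cong (λ s → (Y - A fzero) + ((A fzero + (A i₁ + s) + ℓ * F hy - (ℓ + ν) * A i₁)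
                                        - r * (ℓ * (ℓ + ν))))
                (sym (trans (sumFin-cong other-moment) (sumFin-affine ℓ (A i₁) q))) ⟩
      (Y - A fzero) + (φ₂ F - r * (ℓ * (ℓ + ν)))
        ≡⟨ cong (λ z → (Y - A fzero) + (z - r * (ℓ * (ℓ + ν)))) φ₂F≡ ⟩
      (Y - A fzero) + (r * (ℓ * (ℓ + ν)) - r * (ℓ * (ℓ + ν)))
        ≡⟨ cancel (Y - A fzero) (r * (ℓ * (ℓ + ν))) ⟩
      Y - A fzero ∎
      where
      negate : ∀ r q → r - q ≡ - 1ℤ * q + r
      negate = solve-∀
      cancel : ∀ a b → a + (b - b) ≡ a
      cancel = solve-∀
      identity : ∀ l N a₀ a₁ y r s →
        l * ((y - (a₁ + l * r)) - (r + (- 1ℤ * s + N * r)))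
        ≡ ((a₁ + l * r) - a₀) + ((a₀ + (a₁ + (l * s + N * a₁)) + l * y - (l + (1ℤ + (1ℤ + N))) * a₁)
                                 - r * (l * (l + (1ℤ + (1ℤ + N)))))
      identity = solve-∀
    slope (fsuc fzero) = identity ℓ (A i₁) r
      where identity : ∀ l a r → l * r ≡ (a + l * r) - a
            identity = solve-∀
    slope (fsuc (fsuc t)) = trans (identity ℓ (A i₁) r (q t)) (cong (λ a → Y - a) (sym (other-moment t)))
      where identity : ∀ l a r q → l * (r - q) ≡ (a + l * r) - (l * q + a)
            identity = solve-∀

  vanishes⇒principal : ∀ (F : V → ℤ) → sumH F ≡ 0ℤ → Vanishes F → Principal F
  vanishes⇒principal F degree vanishes with vanishing-slopes F vanishes
  ... | Y , Q , slope , flux = Potential.principal F Y Q slope degree flux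

  section : (Fin n₀ → ℤ) × ℤ → V → ℤ
  section (a , b) hx                            = - b
  section (a , b) hy                            = 0ℤ
  section (a , b) (inner fzero fzero)           = b - sumFin a
  section (a , b) (inner (fsuc (fsuc t)) fzero) = a t
  section (a , b) (inner _ _)                   = 0ℤ

  section-tail : ∀ y i j → section y (inner i (fsuc j)) ≡ 0ℤ
  section-tail y fzero            j = refl
  section-tail y (fsuc fzero)     j = refl
  section-tail y (fsuc (fsuc t))  j = refl

  section-degree : ∀ y → sumH (section y) ≡ 0ℤ
  section-degree (a , b) =
    trans (cong (_+_ (- b + 0ℤ)) (sumFin-cong (λ i → sumFin-head (λ j → section (a , b) (inner i j))
                                                                   (section-tail (a , b) i))))
          (identity b (sumFin a))
    where identity : ∀ b s → (- b + 0ℤ) + ((b - s) + (0ℤ + s)) ≡ 0ℤ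
          identity = solve-∀

  section-moment : ∀ y i → moment (section y) i ≡ section y (inner i fzero)
  section-moment y i = moment-head (section y) i (section-tail y i)

  φ₁-section : ∀ y t → φ₁ t (section y) ≡ proj₁ y t
  φ₁-section y t = trans (cong₂ _-_ (section-moment y (fsuc (fsuc t))) (section-moment y i₁))
                         (+-identityʳ (proj₁ y t))

  φ₂-section : ∀ y → φ₂ (section y) ≡ proj₂ y
  φ₂-section (a , b) =
    trans (cong₂ (λ s m₁ → s + ℓ * 0ℤ - (ℓ + ν) * m₁)
                 (sumFin-cong (section-moment (a , b))) (section-moment (a , b) i₁))
          (identity b (sumFin a) ℓ ν)
    where identity : ∀ b s l v → ((b - s) + (0ℤ + s)) + l * 0ℤ - (l + v) * 0ℤ ≡ b
          identity = solve-∀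

  open RawGroup (Target k n) using (_≈_)

  invariant : (V → ℤ) → (Fin n₀ → ℤ) × ℤ
  invariant D = (λ t → φ₁ t D) , φ₂ D

  hingeOrder≡ : hingeOrder k n ≡ ℓ * (ℓ + ν)
  hingeOrder≡ = identity (+ M) ν
    where identity : ∀ x v → (1ℤ + (1ℤ + x)) * (1ℤ + (1ℤ + x)) + v * (1ℤ + (1ℤ + x))
                             - (1ℤ + 1ℤ) * (1ℤ + (1ℤ + x)) - v + 1ℤ
                             ≡ (1ℤ + x) * ((1ℤ + x) + v)
          identity = solve-∀

  ≈-refl : ∀ {a} → a ≈ a
  ≈-refl {a , b} = (λ t → multiple⇒∣ {+ k - 1ℤ} 0ℤ (i≡j⇒i-j≡0 {a t} refl)) ,
                   multiple⇒∣ {hingeOrder k n} 0ℤ (i≡j⇒i-j≡0 {b} refl)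

  ≈-respʳ : ∀ {a b c} → a ≈ b → (∀ t → proj₁ b t ≡ proj₁ c t) → proj₂ b ≡ proj₂ c → a ≈ c
  ≈-respʳ {a} (a≈b₁ , a≈b₂) e₁ e₂ =
    (λ t → subst (λ x → (+ k - 1ℤ) ∣ (proj₁ a t - x)) (e₁ t) (a≈b₁ t)) ,
    subst (λ x → hingeOrder k n ∣ (proj₂ a - x)) e₂ a≈b₂

  ≡⇒≈ : ∀ {a b} → (∀ t → proj₁ a t ≡ proj₁ b t) → proj₂ a ≡ proj₂ b → a ≈ b
  ≡⇒≈ {a} {b} = ≈-respʳ {a} {a} {b} (≈-refl {a})

  vanishes⇒≈ : ∀ D E → Vanishes (λ v → D v - E v) → invariant D ≈ invariant E
  vanishes⇒≈ D E (quotients , r , eq) =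
    (λ t → multiple⇒∣ (proj₁ (quotients t))
                   (trans (sym (IsLinear.sub-homo (φ₁-linear t) D E)) (proj₂ (quotients t)))) ,
    subst (_∣ (φ₂ D - φ₂ E)) (sym hingeOrder≡)
          (multiple⇒∣ r (trans (sym (IsLinear.sub-homo φ₂-linear D E)) eq))

  ≈⇒vanishes : ∀ D E → invariant D ≈ invariant E → Vanishes (λ v → D v - E v)
  ≈⇒vanishes D E (≈₁ , ≈₂) =
    (λ t → proj₁ (quotient₁ t) , trans (IsLinear.sub-homo (φ₁-linear t) D E) (proj₂ (quotient₁ t))) ,
    (proj₁ quotient₂ , trans (IsLinear.sub-homo φ₂-linear D E) (proj₂ quotient₂))
    where
    quotient₁ : ∀ t → ∃ λ q → φ₁ t D - φ₁ t E ≡ q * ℓ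
    quotient₁ t = ∣⇒multiple (≈₁ t)
    quotient₂ : ∃ λ r → φ₂ D - φ₂ E ≡ r * (ℓ * (ℓ + ν))
    quotient₂ = ∣⇒multiple (subst (_∣ (φ₂ D - φ₂ E)) hingeOrder≡ ≈₂)

  principal⇒vanishes : ∀ {F} → Principal F → Vanishes F
  principal⇒vanishes (f , F≗Lf) = vanishes-≗ F≗Lf (laplacian-vanishes f)

  isomorphism : GroupMorphisms.IsGroupIsomorphism (K-Hinge k n) (Target k n) (invariant ∘ proj₁)
  isomorphism = record
    { isGroupMonomorphism = record
      { isGroupHomomorphism = record
        { isMonoidHomomorphism = record
          { isMagmaHomomorphism = record
            { isRelHomomorphism = record { cong = λ {D} {E} → respects {D} {E} }
            ; homo = λ D E → ≡⇒≈ (λ t → IsLinear.+-homo (φ₁-linear t) (proj₁ D) (proj₁ E))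
                                 (IsLinear.+-homo φ₂-linear (proj₁ D) (proj₁ E)) }
          ; ε-homo = ≡⇒≈ (λ t → IsLinear.0-homo (φ₁-linear t)) (IsLinear.0-homo φ₂-linear) }
        ; ⁻¹-homo = λ D → ≡⇒≈ (λ t → IsLinear.-‿homo (φ₁-linear t) (proj₁ D))
                              (IsLinear.-‿homo φ₂-linear (proj₁ D)) }
      ; injective = λ {D} {E} → injective {D} {E} }
    ; surjective = λ y → (section y , section-degree y) ,
                         λ {z} z∼σ → ≈-respʳ {invariant (proj₁ z)} {invariant (section y)} {y}
                                             (respects {z} {section y , section-degree y} z∼σ) (φ₁-section y) (φ₂-section y) }
    where
    respects : ∀ {D E : Div₀ k n} → D ∼ E → invariant (proj₁ D) ≈ invariant (proj₁ E)
    respects {D , _} {E , _} D∼E = vanishes⇒≈ D E (principal⇒vanishes D∼E)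

    injective : ∀ {D E : Div₀ k n} → invariant (proj₁ D) ≈ invariant (proj₁ E) → D ∼ E
    injective {D , deg-D} {E , deg-E} D≈E =
      vanishes⇒principal (λ v → D v - E v)
        (trans (sumH-+ D (λ v → - E v)) (cong₂ _+_ deg-D (trans (sumH-neg E) (cong -_ deg-E))))
        (≈⇒vanishes D E D≈E)

theorem3p5 : (k n : ℕ) → 3 ≤ k → 2 ≤ n →
    ∃ λ φ → GroupMorphisms.IsGroupIsomorphism (K-Hinge k n) (Target k n) φ
theorem3p5 (suc (suc (suc m₀))) (suc (suc n₀)) (s≤s (s≤s (s≤s z≤n))) (s≤s (s≤s z≤n)) =
  invariant ∘ proj₁ , isomorphism
  where open Invariants m₀ n₀
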